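{- Let $\mathbf{C}$ be a quasitopos and let $\rho$ be a canonical PBPO rule with type morphism $t_L:L\to L'$. Then $$\Rightarrow^{\rho}_{\mathrm{PBPO}} \;=\; \bigcup_{\tau\in\mathrm{compact}(\rho)}\Rightarrow^{\tau}_{\mathrm{PBPO}^+}.$$
   Context: A quasitopos is a category with all finite limits and colimits that is locally cartesian closed and has a regular-subobject classifier; in it every morphism factors as an epimorphism followed by a regular monomorphism. Hooked arrows denote regular monos. PBPO rule $\rho$: spans $L\xleftarrow{l}K\xrightarrow{r}R$ and $L'\xleftarrow{l'}K'\xrightarrow{r'}R'$ with $t_L:L\to L'$, $t_K:K\to K'$, $t_R:R\to R'$ such that $t_Ll=l't_K$ and $t_Rr=r't_K$; canonical if the left square is a pullback and the right square a pushout. PBPO step $G_L\Rightarrow^{\rho}_{\mathrm{PBPO}}G_R$: there exist $m:L\to G_L$, $\alpha:G_L\to L'$ with $t_L=\alpha\circ m$, a pullback $G_L\xleftarrow{g_L}G_K\xrightarrow{u'}K'$ of $G_L\xrightarrow{\alpha}L'\xleftarrow{l'}K'$, the induced $u:K\to G_K$ with $g_Lu=ml$, $u'u=t_K$, and a pushout $G_R$ of $G_K\xleftarrow{u}K\xrightarrow{r}R$. PBPO$^+$ rule $\tau$: $l:K\to L$, $r:K\to R$, $t_L:L\to L'$, $t_K:K\to K'$, $l':K'\to L'$ with $t_L l=l't_K$ a pullback. PBPO$^+$ step $G_L\Rightarrow^{\tau}_{\mathrm{PBPO}^+}G_R$: there exist $m:L\to G_L$, $\alpha:G_L\to L'$ with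 $\alpha m=t_L$ and $L\xleftarrow{1_L}L\xrightarrow{m}G_L$ a pullback of $L\xrightarrow{t_L}L'\xleftarrow{\alpha}G_L$; a pullback $G_L\xleftarrow{g_L}G_K\xrightarrow{u'}K'$ of $\alpha,l'$; $u:K\to G_K$ the unique morphism with $u'u=t_K$; and a pushout $G_R$ of $G_K\xleftarrow{u}K\xrightarrow{r}R$. rm-materialization of $f:A\to B$: a factorization $A\xrightarrow{f'}F\xrightarrow{f''}B$ with $f'$ a regular mono such that for every factorization $A\xrightarrow{m}C\xrightarrow{\alpha}B$ of $f$ with $m$ a regular mono there is a unique $\beta:C\to F$ with $f''\beta=\alpha$ and the square $\beta\circ m=f'\circ 1_A$ a pullback. (These exist in any quasitopos.) Compacted rule: for a canonical PBPO rule $\rho$ and a factorization $t_L=f\circ e$ with $e:L\to L_e$ epic, let $L_e\xrightarrow{f'}F\xrightarrow{f''}L'$ be the rm-materialization of $f$; let $F\xleftarrow{p}F'\xrightarrow{q}K'$ be a pullback of $F\xrightarrow{f''}L'\xleftarrow{l'}K'$; let $L_e\xleftarrow{l_e}K_e\xrightarrow{k}F'$ be a pullback of $L_e\xrightarrow{f'}F\xleftarrow{p}F'$; let $j:K\to K_e$ be induced by these pullbacks from $e\circ l:K\to L_e$ and the morphism $K\to F'$ induced by $f'el$ and $t_K$; and let $K_e\xrightarrow{r_e}R_e\leftarrow R$ be a pushout of $K_e\xleftarrow{j}K\xrightarrow{r}R$. Then $\rho_e$ is the PBPO$^+$ rule with $l=l_e$, $r=r_e$, $t_L=f'$, $t_K=k$,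 $l'=p$ (lhs $L_e$, interface $K_e$, rhs $R_e$, types $F$, $F'$). $\mathrm{compact}(\rho)=\{\rho_e\mid t_L=f\circ e,\ e \text{ epic}\}$. -}

module Defs where

open import Level using (Level; _⊔_; suc)
open import Data.Product using (Σ; Σ-syntax; _×_; _,_)
open import Relation.Binary using (IsEquivalence)

record Category (o ℓ ε : Level) : Set (suc (o ⊔ ℓ ⊔ ε)) where
  infixr 9 _∘_
  infix  4 _≈_
  field
    Obj   : Set o
    _⇒_   : Obj → Obj → Set ℓ
    _≈_   : ∀ {A B} → A ⇒ B → A ⇒ B → Set ε
    id    : ∀ {A} → A ⇒ A
    _∘_   : ∀ {A B C} → B ⇒ C → A ⇒ B → A ⇒ C
    ≈-equiv  : ∀ {A B} → IsEquivalence (_≈_ {A} {B})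
    ∘-resp-≈ : ∀ {A B C} {f h : B ⇒ C} {g i : A ⇒ B} →
               f ≈ h → g ≈ i → f ∘ g ≈ h ∘ i
    assoc    : ∀ {A B C D} {f : A ⇒ B} {g : B ⇒ C} {h : C ⇒ D} →
               (h ∘ g) ∘ f ≈ h ∘ (g ∘ f)
    identityˡ : ∀ {A B} {f : A ⇒ B} → id ∘ f ≈ f
    identityʳ : ∀ {A B} {f : A ⇒ B} → f ∘ id ≈ f

module Notions {o ℓ ε : Level} (C : Category o ℓ ε) where
  open Category C

  private
    lv : Level
    lv = o ⊔ ℓ ⊔ ε

  Mono : ∀ {A B} → A ⇒ B → Set lv
  Mono {A} f = ∀ {X} (g h : X ⇒ A) → f ∘ g ≈ f ∘ h → g ≈ h

  Epi : ∀ {A B} → A ⇒ B → Set lv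
  Epi {B = B} f = ∀ {X} (g h : B ⇒ X) → g ∘ f ≈ h ∘ f → g ≈ h

  record IsPullback {P A B Cc : Obj} (p₁ : P ⇒ A) (p₂ : P ⇒ B)
                    (f : A ⇒ Cc) (g : B ⇒ Cc) : Set lv where
    field
      commute   : f ∘ p₁ ≈ g ∘ p₂
      universal : ∀ {X} (h₁ : X ⇒ A) (h₂ : X ⇒ B) → f ∘ h₁ ≈ g ∘ h₂ →
                  Σ[ u ∈ X ⇒ P ] (p₁ ∘ u ≈ h₁ × p₂ ∘ u ≈ h₂ ×
                    (∀ (v : X ⇒ P) → p₁ ∘ v ≈ h₁ → p₂ ∘ v ≈ h₂ → v ≈ u))

  record IsPushout {P A B Cc : Obj} (i₁ : A ⇒ P) (i₂ : B ⇒ P)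
                   (f : Cc ⇒ A) (g : Cc ⇒ B) : Set lv where
    field
      commute   : i₁ ∘ f ≈ i₂ ∘ g
      universal : ∀ {X} (h₁ : A ⇒ X) (h₂ : B ⇒ X) → h₁ ∘ f ≈ h₂ ∘ g →
                  Σ[ u ∈ P ⇒ X ] (u ∘ i₁ ≈ h₁ × u ∘ i₂ ≈ h₂ ×
                    (∀ (v : P ⇒ X) → v ∘ i₁ ≈ h₁ → v ∘ i₂ ≈ h₂ → v ≈ u))

  record IsEqualizer {E A B : Obj} (m : E ⇒ A) (f g : A ⇒ B) : Set lv where
    field
      equality  : f ∘ m ≈ g ∘ m
      universal : ∀ {X} (h : X ⇒ A) → f ∘ h ≈ g ∘ h →
                  Σ[ u ∈ X ⇒ E ] (m ∘ u ≈ h × (∀ (v : X ⇒ E) → m ∘ v ≈ h → v ≈ u))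

  record IsCoequalizer {Q A B : Obj} (q : B ⇒ Q) (f g : A ⇒ B) : Set lv where
    field
      equality  : q ∘ f ≈ q ∘ g
      universal : ∀ {X} (h : B ⇒ X) → h ∘ f ≈ h ∘ g →
                  Σ[ u ∈ Q ⇒ X ] (u ∘ q ≈ h × (∀ (v : Q ⇒ X) → v ∘ q ≈ h → v ≈ u))

  RegularMono : ∀ {A B} → A ⇒ B → Set lv
  RegularMono {A} {B} m = Σ[ Z ∈ Obj ] Σ[ f ∈ B ⇒ Z ] Σ[ g ∈ B ⇒ Z ] IsEqualizer m f g

  IsTerminal : Obj → Set lv
  IsTerminal T = ∀ X → Σ[ t ∈ X ⇒ T ] (∀ (s : X ⇒ T) → s ≈ t)

  IsInitial : Obj → Set lv
  IsInitial I = ∀ X → Σ[ t ∈ I ⇒ X ] (∀ (s : I ⇒ X) → s ≈ t)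

  record IsProduct {P A B : Obj} (π₁ : P ⇒ A) (π₂ : P ⇒ B) : Set lv where
    field
      universal : ∀ {X} (h₁ : X ⇒ A) (h₂ : X ⇒ B) →
                  Σ[ u ∈ X ⇒ P ] (π₁ ∘ u ≈ h₁ × π₂ ∘ u ≈ h₂ ×
                    (∀ (v : X ⇒ P) → π₁ ∘ v ≈ h₁ → π₂ ∘ v ≈ h₂ → v ≈ u))

  record IsCoproduct {P A B : Obj} (ι₁ : A ⇒ P) (ι₂ : B ⇒ P) : Set lv where
    field
      universal : ∀ {X} (h₁ : A ⇒ X) (h₂ : B ⇒ X) →
                  Σ[ u ∈ P ⇒ X ] (u ∘ ι₁ ≈ h₁ × u ∘ ι₂ ≈ h₂ ×
                    (∀ (v : P ⇒ X) → v ∘ ι₁ ≈ h₁ → v ∘ ι₂ ≈ h₂ → v ≈ u))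

  -- Exponential (q : Z ⇒ B) ^ (p : Y ⇒ B) in the slice C/B.
  -- Binary products in C/B are pullbacks over B; the terminal object of
  -- C/B is id_B.
  record SliceExponential {B Y Z : Obj} (p : Y ⇒ B) (q : Z ⇒ B) : Set lv where
    field
      E   : Obj
      e   : E ⇒ B
      P   : Obj
      π₁  : P ⇒ E
      π₂  : P ⇒ Y
      isPB : IsPullback π₁ π₂ e p
      ev  : P ⇒ Z
      ev-over : q ∘ ev ≈ e ∘ π₁
      universal :
        ∀ {X Q} (x : X ⇒ B) (ρ₁ : Q ⇒ X) (ρ₂ : Q ⇒ Y) → IsPullback ρ₁ ρ₂ x p →
        (h : Q ⇒ Z) → q ∘ h ≈ x ∘ ρ₁ →
        Σ[ λh ∈ X ⇒ E ]
          ((e ∘ λh ≈ x ×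
            (∀ (k : Q ⇒ P) → π₁ ∘ k ≈ λh ∘ ρ₁ → π₂ ∘ k ≈ ρ₂ → ev ∘ k ≈ h)) ×
           (∀ (μ : X ⇒ E) → e ∘ μ ≈ x →
              (∀ (k : Q ⇒ P) → π₁ ∘ k ≈ μ ∘ ρ₁ → π₂ ∘ k ≈ ρ₂ → ev ∘ k ≈ h) →
              μ ≈ λh))

  record Quasitopos : Set lv where
    field
      terminal    : Obj
      isTerminal  : IsTerminal terminal
      products    : ∀ (A B : Obj) → Σ[ P ∈ Obj ] Σ[ π₁ ∈ P ⇒ A ] Σ[ π₂ ∈ P ⇒ B ] IsProduct π₁ π₂
      equalizers  : ∀ {A B} (f g : A ⇒ B) → Σ[ E ∈ Obj ] Σ[ m ∈ E ⇒ A ] IsEqualizer m f g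
      pullbacks   : ∀ {A B Cc} (f : A ⇒ Cc) (g : B ⇒ Cc) →
                    Σ[ P ∈ Obj ] Σ[ p₁ ∈ P ⇒ A ] Σ[ p₂ ∈ P ⇒ B ] IsPullback p₁ p₂ f g
      initial     : Obj
      isInitial   : IsInitial initial
      coproducts  : ∀ (A B : Obj) → Σ[ P ∈ Obj ] Σ[ ι₁ ∈ A ⇒ P ] Σ[ ι₂ ∈ B ⇒ P ] IsCoproduct ι₁ ι₂
      coequalizers : ∀ {A B} (f g : A ⇒ B) → Σ[ Q ∈ Obj ] Σ[ q ∈ B ⇒ Q ] IsCoequalizer q f g
      pushouts    : ∀ {A B Cc} (f : Cc ⇒ A) (g : Cc ⇒ B) →
                    Σ[ P ∈ Obj ] Σ[ i₁ ∈ A ⇒ P ] Σ[ i₂ ∈ B ⇒ P ] IsPushout i₁ i₂ f g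
      -- locally cartesian closed: every slice C/B is cartesian closed
      -- (terminal = id_B and products = pullbacks exist by the above)
      sliceExp    : ∀ {B Y Z} (p : Y ⇒ B) (q : Z ⇒ B) → SliceExponential p q
      Ω           : Obj
      true        : terminal ⇒ Ω
      classify    : ∀ {A X} (m : A ⇒ X) → RegularMono m →
                    Σ[ χ ∈ X ⇒ Ω ] (IsPullback m (Σ.proj₁ (isTerminal A)) χ true ×
                      (∀ (χ′ : X ⇒ Ω) → IsPullback m (Σ.proj₁ (isTerminal A)) χ′ true → χ′ ≈ χ))
      classified-regular : ∀ {A X} (m : A ⇒ X) (t : A ⇒ terminal) (χ : X ⇒ Ω) →
                    IsPullback m t χ true → RegularMono m

  record IsRMMaterialization {A B F : Obj} (f : A ⇒ B) (f′ : A ⇒ F) (f″ : F ⇒ B) : Set lv where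
    field
      factor   : f″ ∘ f′ ≈ f
      regular  : RegularMono f′
      universal : ∀ {Cc} (m : A ⇒ Cc) (α : Cc ⇒ B) → RegularMono m → α ∘ m ≈ f →
                  Σ[ β ∈ Cc ⇒ F ] ((f″ ∘ β ≈ α × IsPullback id m f′ β) ×
                    (∀ (β′ : Cc ⇒ F) → f″ ∘ β′ ≈ α → IsPullback id m f′ β′ → β′ ≈ β))

  record PBPORule : Set lv where
    field
      L K R L′ K′ R′ : Obj
      l  : K ⇒ L
      r  : K ⇒ R
      l′ : K′ ⇒ L′
      r′ : K′ ⇒ R′
      tL : L ⇒ L′
      tK : K ⇒ K′
      tR : R ⇒ R′
      left-comm  : tL ∘ l ≈ l′ ∘ tK
      right-comm : tR ∘ r ≈ r′ ∘ tK

  Canonical : PBPORule → Set lv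
  Canonical ρ = IsPullback l tK tL l′ × IsPushout r′ tR tK r
    where open PBPORule ρ

  record PBPOStep (ρ : PBPORule) (GL GR : Obj) : Set lv where
    open PBPORule ρ
    field
      m   : L ⇒ GL
      α   : GL ⇒ L′
      α-m : α ∘ m ≈ tL
      GK  : Obj
      gL  : GK ⇒ GL
      u′  : GK ⇒ K′
      pb  : IsPullback gL u′ α l′
      u   : K ⇒ GK
      u-l : gL ∘ u ≈ m ∘ l
      u-t : u′ ∘ u ≈ tK
      gR  : GK ⇒ GR
      w   : R ⇒ GR
      po  : IsPushout gR w u r

  record PBPO⁺Rule : Set lv where
    field
      L K R L′ K′ : Obj
      l  : K ⇒ L
      r  : K ⇒ R
      tL : L ⇒ L′
      tK : K ⇒ K′
      l′ : K′ ⇒ L′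
      pb : IsPullback l tK tL l′

  record PBPO⁺Step (τ : PBPO⁺Rule) (GL GR : Obj) : Set lv where
    open PBPO⁺Rule τ
    field
      m   : L ⇒ GL
      α   : GL ⇒ L′
      α-m : α ∘ m ≈ tL
      match-pb : IsPullback id m tL α
      GK  : Obj
      gL  : GK ⇒ GL
      u′  : GK ⇒ K′
      pb-GK : IsPullback gL u′ α l′
      u   : K ⇒ GK
      u-t : u′ ∘ u ≈ tK
      u-unique : ∀ (v : K ⇒ GK) → u′ ∘ v ≈ tK → v ≈ u
      gR  : GK ⇒ GR
      w   : R ⇒ GR
      po  : IsPushout gR w u r

  -- τ ∈ compact(ρ): τ is (up to the choice of the pullbacks, pushout and
  -- rm-materialization, all defined only up to iso) a compacted rule ρ_e.
  -- Components of τ: L = L_e, K = K_e, R = R_e, L′ = F, K′ = F′,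
  -- l = l_e, r = r_e, tL = f′, tK = k, l′ = p.
  record InCompact (ρ : PBPORule) (τ : PBPO⁺Rule) : Set lv where
    private module ρ = PBPORule ρ
    private module τ = PBPO⁺Rule τ
    field
      e      : ρ.L ⇒ τ.L
      e-epi  : Epi e
      f      : τ.L ⇒ ρ.L′
      factor : f ∘ e ≈ ρ.tL
      f″     : τ.L′ ⇒ ρ.L′
      rm     : IsRMMaterialization f τ.tL f″
      q      : τ.K′ ⇒ ρ.K′
      pb-F′  : IsPullback τ.l′ q f″ ρ.l′
      pb-Ke  : IsPullback τ.l τ.tK τ.tL τ.l′
      h      : ρ.K ⇒ τ.K′
      h-p    : τ.l′ ∘ h ≈ τ.tL ∘ (e ∘ ρ.l)
      h-q    : q ∘ h ≈ ρ.tK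
      j      : ρ.K ⇒ τ.K
      j-l    : τ.l ∘ j ≈ e ∘ ρ.l
      j-k    : τ.tK ∘ j ≈ h
      s      : ρ.R ⇒ τ.R
      po-Re  : IsPushout τ.r s j ρ.r

-- Factor the match of a PBPO step as m = i ∘ e, e epic and i a regular mono, and let f = α ∘ i.
-- The rm-materialization f = f″ ∘ f′ provides the unique β with f″ ∘ β = α for which (i, f′) is a
-- pullback of (f′, β): this is the match condition of a PBPO⁺ step of ρ_e with match i and typing β.
-- As the type object F′ of ρ_e is the pullback of l′ along f″, the interface pullback of the PBPO
-- step unpastes into the one for ρ_e, and its result pushout unpastes along the pushout defining R_e.
-- Conversely a PBPO⁺ step of ρ_e, precomposed with e and typed by f″ ∘ β, is a PBPO step because
-- pullbacks and pushouts paste. In a quasitopos the factorization is the equalizer of the cokernel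
-- pair, and the rm-materialization of f : A → B is Π_t f along t = ⟨ true ∘ ! , id ⟩ : B ↪ Ω × B.

module Submission where

open import Defs
open import Level using (Level; _⊔_)
open import Data.Product using (Σ-syntax; _×_; _,_; proj₁; proj₂)
open import Relation.Binary using (IsEquivalence; Setoid)
import Relation.Binary.Reasoning.Setoid as SetoidReasoning

op : ∀ {o ℓ e} → Category o ℓ e → Category o ℓ e
op C = record
  { Obj = Obj ; _⇒_ = λ A B → B ⇒ A ; _≈_ = _≈_ ; id = id ; _∘_ = λ f g → g ∘ f
  ; ≈-equiv = ≈-equiv ; ∘-resp-≈ = λ p q → ∘-resp-≈ q p
  ; assoc = IsEquivalence.sym ≈-equiv assoc
  ; identityˡ = identityʳ ; identityʳ = identityˡ }
  where open Category C

module CategoryReasoning {o ℓ e : Level} (C : Category o ℓ e) where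
  open Category C public
  open Notions C public

  module _ {A B : Obj} where
    open IsEquivalence (≈-equiv {A} {B}) public
      using () renaming (refl to refl≈; sym to sym≈; trans to trans≈)

  hom-setoid : Obj → Obj → Setoid ℓ e
  hom-setoid A B = record { Carrier = A ⇒ B ; _≈_ = _≈_ ; isEquivalence = ≈-equiv }

  module HomReasoning {A B : Obj} = SetoidReasoning (hom-setoid A B)
  open HomReasoning public using (begin_; _∎; step-≈-⟩; step-≈-⟨)

  module _ {A B D : Obj} where
    ∘-resp-≈ˡ : {f h : B ⇒ D} {g : A ⇒ B} → f ≈ h → f ∘ g ≈ h ∘ g
    ∘-resp-≈ˡ p = ∘-resp-≈ p refl≈

    ∘-resp-≈ʳ : {f : B ⇒ D} {g h : A ⇒ B} → g ≈ h → f ∘ g ≈ f ∘ h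
    ∘-resp-≈ʳ p = ∘-resp-≈ refl≈ p

  module _ {A B D E : Obj} {f : A ⇒ B} {g : B ⇒ D} {h : D ⇒ E} where
    sym-assoc : h ∘ (g ∘ f) ≈ (h ∘ g) ∘ f
    sym-assoc = sym≈ assoc

    pullˡ : {k : B ⇒ E} → h ∘ g ≈ k → h ∘ (g ∘ f) ≈ k ∘ f
    pullˡ p = trans≈ sym-assoc (∘-resp-≈ˡ p)

    pushˡ : {k : B ⇒ E} → h ∘ g ≈ k → k ∘ f ≈ h ∘ (g ∘ f)
    pushˡ p = sym≈ (pullˡ p)

    pullʳ : {k : A ⇒ D} → g ∘ f ≈ k → (h ∘ g) ∘ f ≈ h ∘ k
    pullʳ p = trans≈ assoc (∘-resp-≈ʳ p)

  extendʳ : ∀ {A B B′ D E} {f : A ⇒ B} {g : B ⇒ D} {h : D ⇒ E} {j : B ⇒ B′} {k : B′ ⇒ E} →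
            h ∘ g ≈ k ∘ j → h ∘ (g ∘ f) ≈ k ∘ (j ∘ f)
  extendʳ p = trans≈ (pullˡ p) assoc

module Pullbacks {o ℓ e : Level} (C : Category o ℓ e) where
  open CategoryReasoning C

  module _ {P A B D : Obj} {p₁ : P ⇒ A} {p₂ : P ⇒ B} {f : A ⇒ D} {g : B ⇒ D}
           (pb : IsPullback p₁ p₂ f g) where
    open IsPullback pb

    pb-med : ∀ {X} (h₁ : X ⇒ A) (h₂ : X ⇒ B) → f ∘ h₁ ≈ g ∘ h₂ → X ⇒ P
    pb-med h₁ h₂ eq = proj₁ (universal h₁ h₂ eq)

    pb-med-p₁ : ∀ {X} (h₁ : X ⇒ A) (h₂ : X ⇒ B) (eq : f ∘ h₁ ≈ g ∘ h₂) →
                p₁ ∘ pb-med h₁ h₂ eq ≈ h₁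
    pb-med-p₁ h₁ h₂ eq = proj₁ (proj₂ (universal h₁ h₂ eq))

    pb-med-p₂ : ∀ {X} (h₁ : X ⇒ A) (h₂ : X ⇒ B) (eq : f ∘ h₁ ≈ g ∘ h₂) →
                p₂ ∘ pb-med h₁ h₂ eq ≈ h₂
    pb-med-p₂ h₁ h₂ eq = proj₁ (proj₂ (proj₂ (universal h₁ h₂ eq)))

    pb-med-unique : ∀ {X} (h₁ : X ⇒ A) (h₂ : X ⇒ B) (eq : f ∘ h₁ ≈ g ∘ h₂) (v : X ⇒ P) →
                    p₁ ∘ v ≈ h₁ → p₂ ∘ v ≈ h₂ → v ≈ pb-med h₁ h₂ eq
    pb-med-unique h₁ h₂ eq = proj₂ (proj₂ (proj₂ (universal h₁ h₂ eq)))

    pb-jointly-mono : ∀ {X} {v w : X ⇒ P} → p₁ ∘ v ≈ p₁ ∘ w → p₂ ∘ v ≈ p₂ ∘ w → v ≈ w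
    pb-jointly-mono {v = v} {w} eq₁ eq₂ =
      trans≈ (pb-med-unique _ _ (extendʳ commute) v eq₁ eq₂) (sym≈ (pb-med-unique _ _ (extendʳ commute) w refl≈ refl≈))

  IsPullback-resp-≈ : ∀ {P A B D} {p₁ p₁′ : P ⇒ A} {p₂ p₂′ : P ⇒ B} {f f′ : A ⇒ D} {g g′ : B ⇒ D} →
                      p₁ ≈ p₁′ → p₂ ≈ p₂′ → f ≈ f′ → g ≈ g′ →
                      IsPullback p₁ p₂ f g → IsPullback p₁′ p₂′ f′ g′
  IsPullback-resp-≈ e₁ e₂ e-f e-g pb = record
    { commute = trans≈ (sym≈ (∘-resp-≈ e-f e₁)) (trans≈ commute (∘-resp-≈ e-g e₂))
    ; universal = λ h₁ h₂ eq →
        let eq′ = trans≈ (∘-resp-≈ˡ e-f) (trans≈ eq (∘-resp-≈ˡ (sym≈ e-g))) in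
        pb-med pb h₁ h₂ eq′
        , trans≈ (∘-resp-≈ˡ (sym≈ e₁)) (pb-med-p₁ pb h₁ h₂ eq′)
        , trans≈ (∘-resp-≈ˡ (sym≈ e₂)) (pb-med-p₂ pb h₁ h₂ eq′)
        , λ v q₁ q₂ → pb-med-unique pb h₁ h₂ eq′ v (trans≈ (∘-resp-≈ˡ e₁) q₁) (trans≈ (∘-resp-≈ˡ e₂) q₂) }
    where open IsPullback pb

  pullback-pasting : ∀ {P A B D F K} {x : P ⇒ A} {y : P ⇒ B} {f : A ⇒ D} {g : B ⇒ D}
                     {z : B ⇒ K} {h : D ⇒ F} {k : K ⇒ F} →
                     IsPullback x y f g → IsPullback g z h k → IsPullback x (z ∘ y) (h ∘ f) k
  pullback-pasting {x = x} {y} {f} {g} {z} {h} {k} inner outer = record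
    { commute = begin
        (h ∘ f) ∘ x  ≈⟨ pullʳ (IsPullback.commute inner) ⟩
        h ∘ (g ∘ y)  ≈⟨ extendʳ (IsPullback.commute outer) ⟩
        k ∘ (z ∘ y)  ∎
    ; universal = λ c₁ c₂ eq →
        let eq-outer = trans≈ sym-assoc eq
            d = pb-med outer (f ∘ c₁) c₂ eq-outer
            eq-inner = sym≈ (pb-med-p₁ outer (f ∘ c₁) c₂ eq-outer)
        in pb-med inner c₁ d eq-inner
         , pb-med-p₁ inner c₁ d eq-inner
         , trans≈ (pullʳ (pb-med-p₂ inner c₁ d eq-inner)) (pb-med-p₂ outer (f ∘ c₁) c₂ eq-outer)
         , λ v q₁ q₂ →
             let y∘v≈d = pb-jointly-mono outer
                   (trans≈ (pullˡ (sym≈ (IsPullback.commute inner)))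
                           (trans≈ (pullʳ q₁) (sym≈ (pb-med-p₁ outer (f ∘ c₁) c₂ eq-outer))))
                   (trans≈ (trans≈ sym-assoc q₂) (sym≈ (pb-med-p₂ outer (f ∘ c₁) c₂ eq-outer)))
             in pb-jointly-mono inner (trans≈ q₁ (sym≈ (pb-med-p₁ inner c₁ d eq-inner)))
                                      (trans≈ y∘v≈d (sym≈ (pb-med-p₂ inner c₁ d eq-inner))) }

  pullback-unpasting : ∀ {P A B D F K} {x : P ⇒ A} {y : P ⇒ B} {f : A ⇒ D} {g : B ⇒ D}
                       {z : B ⇒ K} {h : D ⇒ F} {k : K ⇒ F} →
                       IsPullback g z h k → IsPullback x (z ∘ y) (h ∘ f) k → f ∘ x ≈ g ∘ y →
                       IsPullback x y f g
  pullback-unpasting {x = x} {y} {f} {g} {z} {h} {k} outer whole commute = record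
    { commute = commute
    ; universal = λ c₁ c₂ eq →
        let eq-whole = trans≈ assoc (trans≈ (∘-resp-≈ʳ eq) (extendʳ (IsPullback.commute outer)))
            u = pb-med whole c₁ (z ∘ c₂) eq-whole
            y∘u≈c₂ = pb-jointly-mono outer
                   (trans≈ (pullˡ (sym≈ commute)) (trans≈ (pullʳ (pb-med-p₁ whole c₁ (z ∘ c₂) eq-whole)) eq))
                   (trans≈ sym-assoc (pb-med-p₂ whole c₁ (z ∘ c₂) eq-whole))
        in u , pb-med-p₁ whole c₁ (z ∘ c₂) eq-whole , y∘u≈c₂
         , λ v q₁ q₂ → pb-jointly-mono whole
             (trans≈ q₁ (sym≈ (pb-med-p₁ whole c₁ (z ∘ c₂) eq-whole)))
             (trans≈ (pullʳ q₂) (sym≈ (pb-med-p₂ whole c₁ (z ∘ c₂) eq-whole))) }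

module Pushouts {o ℓ e : Level} (C : Category o ℓ e) where
  open CategoryReasoning C
  private
    module Op = Pullbacks (op C)

    pushout⇒op-pullback : ∀ {P A B D} {i₁ : A ⇒ P} {i₂ : B ⇒ P} {f : D ⇒ A} {g : D ⇒ B} →
                          IsPushout i₁ i₂ f g → Notions.IsPullback (op C) i₁ i₂ f g
    pushout⇒op-pullback po = record { commute = IsPushout.commute po ; universal = IsPushout.universal po }

    op-pullback⇒pushout : ∀ {P A B D} {i₁ : A ⇒ P} {i₂ : B ⇒ P} {f : D ⇒ A} {g : D ⇒ B} →
                          Notions.IsPullback (op C) i₁ i₂ f g → IsPushout i₁ i₂ f g
    op-pullback⇒pushout pb = record
      { commute = Notions.IsPullback.commute pb ; universal = Notions.IsPullback.universal pb }

  module _ {P A B D : Obj} {i₁ : A ⇒ P} {i₂ : B ⇒ P} {f : D ⇒ A} {g : D ⇒ B}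
           (po : IsPushout i₁ i₂ f g) where
    po-med : ∀ {X} (h₁ : A ⇒ X) (h₂ : B ⇒ X) → h₁ ∘ f ≈ h₂ ∘ g → P ⇒ X
    po-med = Op.pb-med (pushout⇒op-pullback po)

    po-med-i₁ : ∀ {X} (h₁ : A ⇒ X) (h₂ : B ⇒ X) (eq : h₁ ∘ f ≈ h₂ ∘ g) → po-med h₁ h₂ eq ∘ i₁ ≈ h₁
    po-med-i₁ = Op.pb-med-p₁ (pushout⇒op-pullback po)

    po-med-i₂ : ∀ {X} (h₁ : A ⇒ X) (h₂ : B ⇒ X) (eq : h₁ ∘ f ≈ h₂ ∘ g) → po-med h₁ h₂ eq ∘ i₂ ≈ h₂
    po-med-i₂ = Op.pb-med-p₂ (pushout⇒op-pullback po)

  IsPushout-resp-≈ : ∀ {P A B D} {i₁ i₁′ : A ⇒ P} {i₂ i₂′ : B ⇒ P} {f f′ : D ⇒ A} {g g′ : D ⇒ B} →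
                     i₁ ≈ i₁′ → i₂ ≈ i₂′ → f ≈ f′ → g ≈ g′ →
                     IsPushout i₁ i₂ f g → IsPushout i₁′ i₂′ f′ g′
  IsPushout-resp-≈ e₁ e₂ e-f e-g po =
    op-pullback⇒pushout (Op.IsPullback-resp-≈ e₁ e₂ e-f e-g (pushout⇒op-pullback po))

  pushout-pasting : ∀ {P A B D F K} {x : A ⇒ P} {y : B ⇒ P} {f : D ⇒ A} {g : D ⇒ B}
                    {z : K ⇒ B} {h : F ⇒ D} {k : F ⇒ K} →
                    IsPushout x y f g → IsPushout g z h k → IsPushout x (y ∘ z) (f ∘ h) k
  pushout-pasting inner outer =
    op-pullback⇒pushout (Op.pullback-pasting (pushout⇒op-pullback inner) (pushout⇒op-pullback outer))

  pushout-unpasting : ∀ {P A B D F K} {x : A ⇒ P} {y : B ⇒ P} {f : D ⇒ A} {g : D ⇒ B}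
                      {z : K ⇒ B} {h : F ⇒ D} {k : F ⇒ K} →
                      IsPushout g z h k → IsPushout x (y ∘ z) (f ∘ h) k → x ∘ f ≈ y ∘ g →
                      IsPushout x y f g
  pushout-unpasting outer whole commute =
    op-pullback⇒pushout (Op.pullback-unpasting (pushout⇒op-pullback outer) (pushout⇒op-pullback whole) commute)

module Monos {o ℓ e : Level} (C : Category o ℓ e) where
  open CategoryReasoning C
  open Pullbacks C

  RegularMono⇒Mono : ∀ {A B} {m : A ⇒ B} → RegularMono m → Mono m
  RegularMono⇒Mono {m = m} (_ , f , g , eq) x y m∘x≈m∘y =
    trans≈ (unique x m∘x≈m∘y) (sym≈ (unique y refl≈))
    where
      open IsEqualizer eq
      unique : ∀ v → m ∘ v ≈ m ∘ y → v ≈ proj₁ (universal (m ∘ y) (extendʳ equality))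
      unique = proj₂ (proj₂ (universal (m ∘ y) (extendʳ equality)))

  retraction⇒RegularMono : ∀ {A B} {s : A ⇒ B} {r : B ⇒ A} → r ∘ s ≈ id → RegularMono s
  retraction⇒RegularMono {B = B} {s} {r} r∘s≈id = B , id , s ∘ r , record
    { equality = trans≈ identityˡ (sym≈ (trans≈ (pullʳ r∘s≈id) identityʳ))
    ; universal = λ h eq →
        r ∘ h , trans≈ sym-assoc (trans≈ (sym≈ eq) identityˡ)
        , λ v s∘v≈h → trans≈ (sym≈ identityˡ) (trans≈ (∘-resp-≈ˡ (sym≈ r∘s≈id)) (pullʳ s∘v≈h)) }

  Mono⇒IsPullback-id : ∀ {S Y X} {t : S ⇒ Y} → Mono t → (p : X ⇒ S) → IsPullback id p (t ∘ p) t
  Mono⇒IsPullback-id t-mono p = record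
    { commute = identityʳ
    ; universal = λ h₁ h₂ eq → h₁ , identityˡ , t-mono _ _ (trans≈ sym-assoc eq)
                              , λ v q₁ _ → trans≈ (sym≈ identityˡ) q₁ }

  pullback-preserves-Mono : ∀ {P A B D} {p₁ : P ⇒ A} {p₂ : P ⇒ B} {f : A ⇒ D} {g : B ⇒ D} →
                            IsPullback p₁ p₂ f g → Mono g → Mono p₁
  pullback-preserves-Mono pb g-mono x y p₁∘x≈p₁∘y =
    pb-jointly-mono pb p₁∘x≈p₁∘y
      (g-mono _ _ (trans≈ (extendʳ (sym≈ commute)) (trans≈ (∘-resp-≈ʳ p₁∘x≈p₁∘y) (extendʳ commute))))
    where open IsPullback pb

  pullback-preserves-RegularMono : ∀ {P A B D} {p₁ : P ⇒ A} {p₂ : P ⇒ B} {f : A ⇒ D} {g : B ⇒ D} →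
                                   IsPullback p₁ p₂ f g → RegularMono g → RegularMono p₁
  pullback-preserves-RegularMono {p₁ = p₁} {p₂} {f} {g} pb g-reg@(Z , u , v , eq) = Z , u ∘ f , v ∘ f , record
    { equality = begin
        (u ∘ f) ∘ p₁  ≈⟨ pullʳ commute ⟩
        u ∘ (g ∘ p₂)  ≈⟨ extendʳ (IsEqualizer.equality eq) ⟩
        v ∘ (g ∘ p₂)  ≈⟨ pullʳ commute ⟨
        (v ∘ f) ∘ p₁  ∎
    ; universal = λ h eq-h →
        let g-part = IsEqualizer.universal eq (f ∘ h) (trans≈ sym-assoc (trans≈ eq-h assoc))
            eq-pb = sym≈ (proj₁ (proj₂ g-part))
        in pb-med pb h (proj₁ g-part) eq-pb
         , pb-med-p₁ pb h (proj₁ g-part) eq-pb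
         , λ w p₁∘w≈h → pullback-preserves-Mono pb (RegularMono⇒Mono g-reg) _ _
             (trans≈ p₁∘w≈h (sym≈ (pb-med-p₁ pb h (proj₁ g-part) eq-pb))) }
    where open IsPullback pb

module Constructions {o ℓ ε : Level} (C : Category o ℓ ε) where
  open CategoryReasoning C

  record Pullback {A B D : Obj} (f : A ⇒ D) (g : B ⇒ D) : Set (o ⊔ ℓ ⊔ ε) where
    field
      {P}        : Obj
      p₁         : P ⇒ A
      p₂         : P ⇒ B
      isPullback : IsPullback p₁ p₂ f g

  record Pushout {A B D : Obj} (f : D ⇒ A) (g : D ⇒ B) : Set (o ⊔ ℓ ⊔ ε) where
    field
      {P}       : Obj
      i₁        : A ⇒ P
      i₂        : B ⇒ P
      isPushout : IsPushout i₁ i₂ f g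

  record Product (A B : Obj) : Set (o ⊔ ℓ ⊔ ε) where
    field
      {A×B}     : Obj
      π₁        : A×B ⇒ A
      π₂        : A×B ⇒ B
      isProduct : IsProduct π₁ π₂

    ⟨_,_⟩ : ∀ {W} → W ⇒ A → W ⇒ B → W ⇒ A×B
    ⟨ h₁ , h₂ ⟩ = proj₁ (IsProduct.universal isProduct h₁ h₂)

    π₁∘⟨⟩ : ∀ {W} {h₁ : W ⇒ A} {h₂ : W ⇒ B} → π₁ ∘ ⟨ h₁ , h₂ ⟩ ≈ h₁
    π₁∘⟨⟩ {h₁ = h₁} {h₂} = proj₁ (proj₂ (IsProduct.universal isProduct h₁ h₂))

    π₂∘⟨⟩ : ∀ {W} {h₁ : W ⇒ A} {h₂ : W ⇒ B} → π₂ ∘ ⟨ h₁ , h₂ ⟩ ≈ h₂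
    π₂∘⟨⟩ {h₁ = h₁} {h₂} = proj₁ (proj₂ (proj₂ (IsProduct.universal isProduct h₁ h₂)))

    product-jointly-mono : ∀ {W} {v w : W ⇒ A×B} → π₁ ∘ v ≈ π₁ ∘ w → π₂ ∘ v ≈ π₂ ∘ w → v ≈ w
    product-jointly-mono {v = v} {w} eq₁ eq₂ = trans≈ (unique v eq₁ eq₂) (sym≈ (unique w refl≈ refl≈))
      where
        unique : ∀ u → π₁ ∘ u ≈ π₁ ∘ w → π₂ ∘ u ≈ π₂ ∘ w → u ≈ ⟨ π₁ ∘ w , π₂ ∘ w ⟩
        unique = proj₂ (proj₂ (proj₂ (IsProduct.universal isProduct (π₁ ∘ w) (π₂ ∘ w))))

  record EpiRegularMonoFactorization {A B : Obj} (m : A ⇒ B) : Set (o ⊔ ℓ ⊔ ε) where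
    field
      {I}     : Obj
      e       : A ⇒ I
      i       : I ⇒ B
      epi     : Epi e
      regular : RegularMono i
      factors : i ∘ e ≈ m

  record RMMaterialization {A B : Obj} (f : A ⇒ B) : Set (o ⊔ ℓ ⊔ ε) where
    field
      {F}  : Obj
      f′   : A ⇒ F
      f″   : F ⇒ B
      isRM : IsRMMaterialization f f′ f″

module QuasitoposProperties {o ℓ ε : Level} (C : Category o ℓ ε) (Q : Notions.Quasitopos C) where
  open CategoryReasoning C
  open Pullbacks C
  open Pushouts C
  open Monos C
  open Constructions C
  open Quasitopos Q

  ! : ∀ {X} → X ⇒ terminal
  ! {X} = proj₁ (isTerminal X)

  !-unique : ∀ {X} (f g : X ⇒ terminal) → f ≈ g
  !-unique {X} f g = trans≈ (proj₂ (isTerminal X) f) (sym≈ (proj₂ (isTerminal X) g))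

  true-mono : Mono true
  true-mono g h _ = !-unique g h

  pullback : ∀ {A B D} (f : A ⇒ D) (g : B ⇒ D) → Pullback f g
  pullback f g = let (_ , p₁ , p₂ , pb) = pullbacks f g in
    record { p₁ = p₁ ; p₂ = p₂ ; isPullback = pb }

  pushout : ∀ {A B D} (f : D ⇒ A) (g : D ⇒ B) → Pushout f g
  pushout f g = let (_ , i₁ , i₂ , po) = pushouts f g in
    record { i₁ = i₁ ; i₂ = i₂ ; isPushout = po }

  product : ∀ A B → Product A B
  product A B = let (_ , π₁ , π₂ , isProduct) = products A B in
    record { π₁ = π₁ ; π₂ = π₂ ; isProduct = isProduct }

  -- E, e is the dependent product Π_t X of p : X ⇒ S along the mono t : S ⇒ Y, built as the
  -- exponential (t ∘ p)^t in C/Y (whose product with t is the pullback P).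
  module Π-along-mono {S Y X : Obj} (t : S ⇒ Y) (t-mono : Mono t) (p : X ⇒ S) where
    open SliceExponential (sliceExp t (t ∘ p)) public

    p∘ev≈π₂ : p ∘ ev ≈ π₂
    p∘ev≈π₂ = t-mono _ _ (trans≈ sym-assoc (trans≈ ev-over (IsPullback.commute isPB)))

    record Transpose {Z Z′} (z : Z ⇒ Y) (a : Z′ ⇒ S) (b : Z′ ⇒ Z) (h : Z′ ⇒ X) : Set (o ⊔ ℓ ⊔ ε) where
      field
        ĥ         : Z ⇒ E
        over      : e ∘ ĥ ≈ z
        evaluates : ∀ k → π₁ ∘ k ≈ ĥ ∘ b → π₂ ∘ k ≈ a → ev ∘ k ≈ h

    transpose : ∀ {Z Z′} (z : Z ⇒ Y) (a : Z′ ⇒ S) (b : Z′ ⇒ Z) → IsPullback b a z t →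
                (h : Z′ ⇒ X) → p ∘ h ≈ a → Transpose z a b h
    transpose z a b pb h p∘h≈a = record
      { ĥ = proj₁ (universal z b a pb h h-over)
      ; over = proj₁ (proj₁ (proj₂ (universal z b a pb h h-over)))
      ; evaluates = proj₂ (proj₁ (proj₂ (universal z b a pb h h-over))) }
      where
        h-over : (t ∘ p) ∘ h ≈ z ∘ b
        h-over = trans≈ assoc (trans≈ (∘-resp-≈ʳ p∘h≈a) (sym≈ (IsPullback.commute pb)))

    transpose-unique : ∀ {Z Z′} (z : Z ⇒ Y) (a : Z′ ⇒ S) (b : Z′ ⇒ Z) → IsPullback b a z t →
                       (w₁ w₂ : Z ⇒ E) → e ∘ w₁ ≈ z → e ∘ w₂ ≈ z → (c₁ c₂ : Z′ ⇒ P) →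
                       π₁ ∘ c₁ ≈ w₁ ∘ b → π₂ ∘ c₁ ≈ a → π₁ ∘ c₂ ≈ w₂ ∘ b → π₂ ∘ c₂ ≈ a →
                       ev ∘ c₁ ≈ ev ∘ c₂ → w₁ ≈ w₂
    transpose-unique z a b pb w₁ w₂ e∘w₁≈z e∘w₂≈z c₁ c₂ c₁-π₁ c₁-π₂ c₂-π₁ c₂-π₂ ev-c₁≈ev-c₂ =
      trans≈ (unique w₁ e∘w₁≈z ev∘-w₁) (sym≈ (unique w₂ e∘w₂≈z ev∘-w₂))
      where
        over : (t ∘ p) ∘ (ev ∘ c₁) ≈ z ∘ b
        over = trans≈ assoc (trans≈ (∘-resp-≈ʳ (trans≈ (pullˡ p∘ev≈π₂) c₁-π₂)) (sym≈ (IsPullback.commute pb)))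
        unique : ∀ μ → e ∘ μ ≈ z → (∀ k → π₁ ∘ k ≈ μ ∘ b → π₂ ∘ k ≈ a → ev ∘ k ≈ ev ∘ c₁) →
                 μ ≈ proj₁ (universal z b a pb (ev ∘ c₁) over)
        unique = proj₂ (proj₂ (universal z b a pb (ev ∘ c₁) over))
        ev∘-w₁ : ∀ k → π₁ ∘ k ≈ w₁ ∘ b → π₂ ∘ k ≈ a → ev ∘ k ≈ ev ∘ c₁
        ev∘-w₁ k k-π₁ k-π₂ =
          ∘-resp-≈ʳ (pb-jointly-mono isPB (trans≈ k-π₁ (sym≈ c₁-π₁)) (trans≈ k-π₂ (sym≈ c₁-π₂)))
        ev∘-w₂ : ∀ k → π₁ ∘ k ≈ w₂ ∘ b → π₂ ∘ k ≈ a → ev ∘ k ≈ ev ∘ c₁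
        ev∘-w₂ k k-π₁ k-π₂ = trans≈
          (∘-resp-≈ʳ (pb-jointly-mono isPB (trans≈ k-π₁ (sym≈ c₂-π₁)) (trans≈ k-π₂ (sym≈ c₂-π₂))))
          (sym≈ ev-c₁≈ev-c₂)

    private
      module Tη = Transpose (transpose (t ∘ p) p id (Mono⇒IsPullback-id t-mono p) id identityʳ)

    η : X ⇒ E
    η = Tη.ĥ

    η-over : e ∘ η ≈ t ∘ p
    η-over = Tη.over

    η-pair : X ⇒ P
    η-pair = pb-med isPB η p η-over

    η-pair-π₁ : π₁ ∘ η-pair ≈ η
    η-pair-π₁ = pb-med-p₁ isPB η p η-over

    η-pair-π₂ : π₂ ∘ η-pair ≈ p
    η-pair-π₂ = pb-med-p₂ isPB η p η-over

    ev∘η-pair≈id : ev ∘ η-pair ≈ id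
    ev∘η-pair≈id = Tη.evaluates η-pair (trans≈ η-pair-π₁ (sym≈ identityʳ)) η-pair-π₂

    η-pullback : IsPullback η p e t
    η-pullback = record
      { commute = η-over
      ; universal = λ c k eq →
          let d = pb-med isPB c k eq
              p∘ev∘d≈k = trans≈ (pullˡ p∘ev≈π₂) (pb-med-p₂ isPB c k eq)
              η∘ev∘d≈c = transpose-unique (t ∘ k) k id (Mono⇒IsPullback-id t-mono k)
                           (η ∘ (ev ∘ d)) c (trans≈ (pullˡ η-over) (trans≈ assoc (∘-resp-≈ʳ p∘ev∘d≈k))) eq
                           (η-pair ∘ (ev ∘ d)) d
                           (trans≈ (pullˡ η-pair-π₁) (sym≈ identityʳ))
                           (trans≈ (pullˡ η-pair-π₂) p∘ev∘d≈k)
                           (trans≈ (pb-med-p₁ isPB c k eq) (sym≈ identityʳ))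
                           (pb-med-p₂ isPB c k eq)
                           (trans≈ (pullˡ ev∘η-pair≈id) identityˡ)
          in ev ∘ d , η∘ev∘d≈c , p∘ev∘d≈k
           , λ v q₁ q₂ →
               let η-pair∘v≈d = pb-jointly-mono isPB
                     (trans≈ (pullˡ η-pair-π₁) (trans≈ q₁ (sym≈ (pb-med-p₁ isPB c k eq))))
                     (trans≈ (pullˡ η-pair-π₂) (trans≈ q₂ (sym≈ (pb-med-p₂ isPB c k eq))))
               in trans≈ (sym≈ identityˡ) (trans≈ (∘-resp-≈ˡ (sym≈ ev∘η-pair≈id)) (pullʳ η-pair∘v≈d)) }

    η-mono : Mono η
    η-mono = pullback-preserves-Mono η-pullback t-mono

  module RegularPartialMapClassifier (X : Obj) where
    open Π-along-mono true true-mono (! {X}) public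

    extend : ∀ {I G} (i : I ⇒ G) → RegularMono i → (x : I ⇒ X) → Σ[ x̂ ∈ G ⇒ E ] (x̂ ∘ i ≈ η ∘ x)
    extend {I} {G} i i-regular x = x̂ , x̂∘i≈η∘x
      where
        χ : G ⇒ Ω
        χ = proj₁ (classify i i-regular)
        χ-pullback : IsPullback i ! χ true
        χ-pullback = proj₁ (proj₂ (classify i i-regular))
        module X̂ = Transpose (transpose χ ! i χ-pullback x (!-unique _ _))
        x̂ : G ⇒ E
        x̂ = X̂.ĥ
        e∘x̂∘i : e ∘ (x̂ ∘ i) ≈ true ∘ ! {I}
        e∘x̂∘i = trans≈ (pullˡ X̂.over) (IsPullback.commute χ-pullback)
        e∘η∘x : e ∘ (η ∘ x) ≈ true ∘ ! {I}
        e∘η∘x = trans≈ (pullˡ η-over) (trans≈ assoc (∘-resp-≈ʳ (!-unique _ _)))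
        x̂∘i≈η∘x : x̂ ∘ i ≈ η ∘ x
        x̂∘i≈η∘x = transpose-unique (true ∘ !) ! id (Mono⇒IsPullback-id true-mono !)
          (x̂ ∘ i) (η ∘ x) e∘x̂∘i e∘η∘x
          (pb-med isPB (x̂ ∘ i) ! e∘x̂∘i) (η-pair ∘ x)
          (trans≈ (pb-med-p₁ isPB _ _ e∘x̂∘i) (sym≈ identityʳ))
          (pb-med-p₂ isPB _ _ e∘x̂∘i)
          (trans≈ (pullˡ η-pair-π₁) (sym≈ identityʳ))
          (trans≈ (pullˡ η-pair-π₂) (!-unique _ _))
          (trans≈ (X̂.evaluates _ (pb-med-p₁ isPB _ _ e∘x̂∘i) (pb-med-p₂ isPB _ _ e∘x̂∘i))
                  (sym≈ (trans≈ (pullˡ ev∘η-pair≈id) identityˡ)))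

  -- m factors through the equalizer i of its cokernel pair; the factor g is epic because maps
  -- out of I extend along the regular mono i into a partial map classifier, where η is mono.
  epi-regular-factorization : ∀ {A B} (m : A ⇒ B) → EpiRegularMonoFactorization m
  epi-regular-factorization {A} {B} m =
    record { e = g ; i = i ; epi = g-epi ; regular = i-regular ; factors = i∘g≈m }
    where
      open Pushout (pushout m m) using () renaming (P to Cok; i₁ to c₁; i₂ to c₂; isPushout to cokernel-pair)
      I : Obj
      I = proj₁ (equalizers c₁ c₂)
      i : I ⇒ B
      i = proj₁ (proj₂ (equalizers c₁ c₂))
      i-equalizer : IsEqualizer i c₁ c₂
      i-equalizer = proj₂ (proj₂ (equalizers c₁ c₂))
      i-regular : RegularMono i
      i-regular = _ , c₁ , c₂ , i-equalizer
      g : A ⇒ I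
      g = proj₁ (IsEqualizer.universal i-equalizer m (IsPushout.commute cokernel-pair))
      i∘g≈m : i ∘ g ≈ m
      i∘g≈m = proj₁ (proj₂ (IsEqualizer.universal i-equalizer m (IsPushout.commute cokernel-pair)))
      g-epi : Epi g
      g-epi {X} x y x∘g≈y∘g = η-mono x y (begin
          η ∘ x  ≈⟨ proj₂ x̂ ⟨
          proj₁ x̂ ∘ i  ≈⟨ ∘-resp-≈ˡ (po-med-i₁ cokernel-pair _ _ x̂∘m≈ŷ∘m) ⟨
          (u ∘ c₁) ∘ i  ≈⟨ pullʳ (IsEqualizer.equality i-equalizer) ⟩
          u ∘ (c₂ ∘ i)  ≈⟨ pullˡ (po-med-i₂ cokernel-pair _ _ x̂∘m≈ŷ∘m) ⟩
          proj₁ ŷ ∘ i  ≈⟨ proj₂ ŷ ⟩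
          η ∘ y  ∎)
        where
          open RegularPartialMapClassifier X
          x̂ : Σ[ x̂ ∈ B ⇒ E ] (x̂ ∘ i ≈ η ∘ x)
          x̂ = extend i i-regular x
          ŷ : Σ[ ŷ ∈ B ⇒ E ] (ŷ ∘ i ≈ η ∘ y)
          ŷ = extend i i-regular y
          x̂∘m≈ŷ∘m : proj₁ x̂ ∘ m ≈ proj₁ ŷ ∘ m
          x̂∘m≈ŷ∘m = begin
            proj₁ x̂ ∘ m  ≈⟨ ∘-resp-≈ʳ i∘g≈m ⟨
            proj₁ x̂ ∘ (i ∘ g)  ≈⟨ pullˡ (proj₂ x̂) ⟩
            (η ∘ x) ∘ g  ≈⟨ pullʳ x∘g≈y∘g ⟩
            η ∘ (y ∘ g)  ≈⟨ sym-assoc ⟩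
            (η ∘ y) ∘ g  ≈⟨ pushˡ (proj₂ ŷ) ⟩
            proj₁ ŷ ∘ (i ∘ g)  ≈⟨ ∘-resp-≈ʳ i∘g≈m ⟩
            proj₁ ŷ ∘ m  ∎
          u : Cok ⇒ E
          u = po-med cokernel-pair (proj₁ x̂) (proj₁ ŷ) x̂∘m≈ŷ∘m

  -- A factorization α ∘ m of f with m regular is classified by ⟨ χ , α ⟩, χ the characteristic map of m.
  module Materialization {A B : Obj} (f : A ⇒ B) where
    open Product (product Ω B) renaming (A×B to Ω×B; π₁ to πΩ; π₂ to πB)

    t : B ⇒ Ω×B
    t = ⟨ true ∘ ! , id ⟩

    t-regular : RegularMono t
    t-regular = retraction⇒RegularMono π₂∘⟨⟩

    πΩ∘t : ∀ {W} (k : W ⇒ B) → πΩ ∘ (t ∘ k) ≈ true ∘ ! {W}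
    πΩ∘t k = trans≈ (pullˡ π₁∘⟨⟩) (trans≈ assoc (∘-resp-≈ʳ (!-unique _ _)))

    πB∘t : ∀ {W} (k : W ⇒ B) → πB ∘ (t ∘ k) ≈ k
    πB∘t k = trans≈ (pullˡ π₂∘⟨⟩) identityˡ

    open Π-along-mono t (RegularMono⇒Mono t-regular) f public

    f″ : E ⇒ B
    f″ = πB ∘ e

    f″∘η≈f : f″ ∘ η ≈ f
    f″∘η≈f = trans≈ (pullʳ η-over) (πB∘t f)

    η-regular : RegularMono η
    η-regular = pullback-preserves-RegularMono η-pullback t-regular

    module Through {Cc : Obj} (m : A ⇒ Cc) (α : Cc ⇒ B) (m-regular : RegularMono m) (α∘m≈f : α ∘ m ≈ f) where
      χ : Cc ⇒ Ω
      χ = proj₁ (classify m m-regular)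

      χ-pullback : IsPullback m ! χ true
      χ-pullback = proj₁ (proj₂ (classify m m-regular))

      z : Cc ⇒ Ω×B
      z = ⟨ χ , α ⟩

      χ∘c≈true : ∀ {W} (c : W ⇒ Cc) (k : W ⇒ B) → z ∘ c ≈ t ∘ k → χ ∘ c ≈ true ∘ ! {W}
      χ∘c≈true c k eq = trans≈ (sym≈ (pullˡ π₁∘⟨⟩)) (trans≈ (∘-resp-≈ʳ eq) (πΩ∘t k))

      z-pullback : IsPullback m f z t
      z-pullback = record
        { commute = product-jointly-mono
            (trans≈ (pullˡ π₁∘⟨⟩) (trans≈ (IsPullback.commute χ-pullback) (sym≈ (πΩ∘t f))))
            (trans≈ (pullˡ π₂∘⟨⟩) (trans≈ α∘m≈f (sym≈ (πB∘t f))))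
        ; universal = λ c k eq →
            let χ∘c = χ∘c≈true c k eq
                m∘y≈c = pb-med-p₁ χ-pullback c ! χ∘c
            in pb-med χ-pullback c ! χ∘c , m∘y≈c
             , (begin
                 f ∘ _  ≈⟨ ∘-resp-≈ˡ α∘m≈f ⟨
                 (α ∘ m) ∘ _  ≈⟨ pullʳ m∘y≈c ⟩
                 α ∘ c  ≈⟨ pullˡ π₂∘⟨⟩ ⟨
                 πB ∘ (z ∘ c)  ≈⟨ ∘-resp-≈ʳ eq ⟩
                 πB ∘ (t ∘ k)  ≈⟨ πB∘t k ⟩
                 k  ∎)
             , λ v q₁ _ → RegularMono⇒Mono m-regular _ _ (trans≈ q₁ (sym≈ m∘y≈c)) }

      private
        module Tβ = Transpose (transpose z f m z-pullback id identityʳ)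

      β : Cc ⇒ E
      β = Tβ.ĥ

      β-over : e ∘ β ≈ z
      β-over = Tβ.over

      f″∘β≈α : f″ ∘ β ≈ α
      f″∘β≈α = trans≈ (pullʳ β-over) π₂∘⟨⟩

      β∘m≈η : β ∘ m ≈ η
      β∘m≈η = transpose-unique (t ∘ f) f id (Mono⇒IsPullback-id (RegularMono⇒Mono t-regular) f)
        (β ∘ m) η e∘β∘m η-over β-pair η-pair
        (trans≈ (pb-med-p₁ isPB _ _ e∘β∘m) (sym≈ identityʳ)) (pb-med-p₂ isPB _ _ e∘β∘m)
        (trans≈ η-pair-π₁ (sym≈ identityʳ)) η-pair-π₂
        (trans≈ (Tβ.evaluates β-pair (pb-med-p₁ isPB _ _ e∘β∘m) (pb-med-p₂ isPB _ _ e∘β∘m))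
                (sym≈ ev∘η-pair≈id))
        where
          e∘β∘m : e ∘ (β ∘ m) ≈ t ∘ f
          e∘β∘m = trans≈ (pullˡ β-over) (IsPullback.commute z-pullback)
          β-pair : A ⇒ P
          β-pair = pb-med isPB (β ∘ m) f e∘β∘m

      β-pullback : IsPullback id m η β
      β-pullback = record
        { commute = trans≈ identityʳ (sym≈ β∘m≈η)
        ; universal = λ y c η∘y≈β∘c →
            let z∘c≈t∘f∘y = begin
                  z ∘ c  ≈⟨ pullˡ β-over ⟨
                  e ∘ (β ∘ c)  ≈⟨ ∘-resp-≈ʳ η∘y≈β∘c ⟨
                  e ∘ (η ∘ y)  ≈⟨ pullˡ η-over ⟩
                  (t ∘ f) ∘ y  ≈⟨ assoc ⟩
                  t ∘ (f ∘ y)  ∎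
                χ∘c = χ∘c≈true c (f ∘ y) z∘c≈t∘f∘y
                m∘y′≈c = pb-med-p₁ χ-pullback c ! χ∘c
                y≈y′ = η-mono _ _ (trans≈ η∘y≈β∘c (trans≈ (∘-resp-≈ʳ (sym≈ m∘y′≈c)) (pullˡ β∘m≈η)))
            in y , identityˡ , trans≈ (∘-resp-≈ʳ y≈y′) m∘y′≈c
             , λ v q₁ _ → trans≈ (sym≈ identityˡ) q₁ }

      over-z-unique : ∀ (w₁ w₂ : Cc ⇒ E) → e ∘ w₁ ≈ z → e ∘ w₂ ≈ z → w₁ ∘ m ≈ η → w₂ ∘ m ≈ η → w₁ ≈ w₂
      over-z-unique w₁ w₂ e∘w₁ e∘w₂ w₁∘m w₂∘m = transpose-unique z f m z-pullback w₁ w₂ e∘w₁ e∘w₂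
        η-pair η-pair (trans≈ η-pair-π₁ (sym≈ w₁∘m)) η-pair-π₂ (trans≈ η-pair-π₁ (sym≈ w₂∘m)) η-pair-π₂ refl≈

      square⇒∘m≈η : ∀ {β′ : Cc ⇒ E} → IsPullback id m η β′ → β′ ∘ m ≈ η
      square⇒∘m≈η square = sym≈ (trans≈ (sym≈ identityʳ) (IsPullback.commute square))

      pullback-square⇒classifies-m : ∀ (β′ : Cc ⇒ E) → IsPullback id m η β′ → IsPullback m ! (πΩ ∘ (e ∘ β′)) true
      pullback-square⇒classifies-m β′ square = record
        { commute = trans≈ (pullʳ (pullʳ (square⇒∘m≈η square))) (trans≈ (∘-resp-≈ʳ η-over) (πΩ∘t f))
        ; universal = λ c k eq →
            let b = πB ∘ (e ∘ (β′ ∘ c))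
                e∘β′∘c≈t∘b = product-jointly-mono
                  (trans≈ (∘-resp-≈ʳ sym-assoc) (trans≈ sym-assoc (trans≈ eq
                    (trans≈ (∘-resp-≈ʳ (!-unique _ _)) (sym≈ (πΩ∘t b))))))
                  (sym≈ (πB∘t b))
                y = pb-med η-pullback (β′ ∘ c) b e∘β′∘c≈t∘b
                η∘y≈β′∘c = pb-med-p₁ η-pullback (β′ ∘ c) b e∘β′∘c≈t∘b
                m∘u≈c = pb-med-p₂ square y c η∘y≈β′∘c
            in pb-med square y c η∘y≈β′∘c , m∘u≈c , !-unique _ _
             , λ v q₁ _ → RegularMono⇒Mono m-regular _ _ (trans≈ q₁ (sym≈ m∘u≈c)) }

      β-unique : ∀ (β′ : Cc ⇒ E) → f″ ∘ β′ ≈ α → IsPullback id m η β′ → β′ ≈ β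
      β-unique β′ f″∘β′≈α square = over-z-unique β′ β e∘β′≈z β-over (square⇒∘m≈η square) β∘m≈η
        where
          e∘β′≈z : e ∘ β′ ≈ z
          e∘β′≈z = product-jointly-mono
            (trans≈ (proj₂ (proj₂ (classify m m-regular)) _ (pullback-square⇒classifies-m β′ square))
                    (sym≈ π₁∘⟨⟩))
            (trans≈ sym-assoc (trans≈ f″∘β′≈α (sym≈ π₂∘⟨⟩)))

  rm-materialization : ∀ {A B} (f : A ⇒ B) → RMMaterialization f
  rm-materialization f = record
    { f′ = η ; f″ = f″
    ; isRM = record
      { factor = f″∘η≈f
      ; regular = η-regular
      ; universal = λ m α m-regular α∘m≈f →
          let open Through m α m-regular α∘m≈f in β , (f″∘β≈α , β-pullback) , β-unique } }
    where open Materialization f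

module Rewriting {o ℓ ε : Level} (C : Category o ℓ ε) where
  open CategoryReasoning C
  open Pullbacks C
  open Pushouts C
  open Constructions C

  PBPO⁺Step-gL∘u : ∀ {τ GL GR} (st : PBPO⁺Step τ GL GR) →
                   PBPO⁺Step.gL st ∘ PBPO⁺Step.u st ≈ PBPO⁺Step.m st ∘ PBPO⁺Rule.l τ
  PBPO⁺Step-gL∘u {τ} st = trans≈ (∘-resp-≈ʳ (sym≈ (u-unique v (pb-med-p₂ pb-GK _ _ commutes))))
                                 (pb-med-p₁ pb-GK _ _ commutes)
    where
      open PBPO⁺Step st
      commutes : α ∘ (m ∘ PBPO⁺Rule.l τ) ≈ PBPO⁺Rule.l′ τ ∘ PBPO⁺Rule.tK τ
      commutes = trans≈ (pullˡ α-m) (IsPullback.commute (PBPO⁺Rule.pb τ))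
      v : PBPO⁺Rule.K τ ⇒ GK
      v = pb-med pb-GK _ _ commutes

  compact-PBPO⁺Step⇒PBPOStep : ∀ {ρ τ GL GR} → InCompact ρ τ → PBPO⁺Step τ GL GR → PBPOStep ρ GL GR
  compact-PBPO⁺Step⇒PBPOStep {ρ} {τ} ic st = record
    { m = S.m ∘ I.e ; α = I.f″ ∘ S.α ; α-m = α-m
    ; GK = S.GK ; gL = S.gL ; u′ = I.q ∘ S.u′ ; pb = pullback-pasting S.pb-GK I.pb-F′
    ; u = S.u ∘ I.j ; u-l = u-l ; u-t = u-t
    ; gR = S.gR ; w = S.w ∘ I.s ; po = pushout-pasting S.po I.po-Re }
    where
      module ρ = PBPORule ρ
      module τ = PBPO⁺Rule τ
      module I = InCompact ic
      module S = PBPO⁺Step st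
      α-m : (I.f″ ∘ S.α) ∘ (S.m ∘ I.e) ≈ ρ.tL
      α-m = begin
        (I.f″ ∘ S.α) ∘ (S.m ∘ I.e)  ≈⟨ pullʳ (pullˡ S.α-m) ⟩
        I.f″ ∘ (τ.tL ∘ I.e)         ≈⟨ pullˡ (IsRMMaterialization.factor I.rm) ⟩
        I.f ∘ I.e                   ≈⟨ I.factor ⟩
        ρ.tL                        ∎
      u-l : S.gL ∘ (S.u ∘ I.j) ≈ (S.m ∘ I.e) ∘ ρ.l
      u-l = begin
        S.gL ∘ (S.u ∘ I.j)  ≈⟨ pullˡ (PBPO⁺Step-gL∘u st) ⟩
        (S.m ∘ τ.l) ∘ I.j   ≈⟨ pullʳ I.j-l ⟩
        S.m ∘ (I.e ∘ ρ.l)   ≈⟨ sym-assoc ⟩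
        (S.m ∘ I.e) ∘ ρ.l   ∎
      u-t : (I.q ∘ S.u′) ∘ (S.u ∘ I.j) ≈ ρ.tK
      u-t = begin
        (I.q ∘ S.u′) ∘ (S.u ∘ I.j)  ≈⟨ pullʳ (pullˡ S.u-t) ⟩
        I.q ∘ (τ.tK ∘ I.j)          ≈⟨ ∘-resp-≈ʳ I.j-k ⟩
        I.q ∘ I.h                   ≈⟨ I.h-q ⟩
        ρ.tK                        ∎

  module CompactedStep {ρ τ GL GR} (ic : InCompact ρ τ) (st : PBPOStep ρ GL GR)
                     {i : PBPO⁺Rule.L τ ⇒ GL} (i-regular : RegularMono i)
                     (i∘e≈m : i ∘ InCompact.e ic ≈ PBPOStep.m st)
                     (α∘i≈f : PBPOStep.α st ∘ i ≈ InCompact.f ic) where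
    private
      module ρ = PBPORule ρ
      module τ = PBPO⁺Rule τ
      module I = InCompact ic
      module S = PBPOStep st
      β-data : Σ[ β ∈ GL ⇒ τ.L′ ] ((I.f″ ∘ β ≈ S.α × IsPullback id i τ.tL β) ×
                 (∀ β′ → I.f″ ∘ β′ ≈ S.α → IsPullback id i τ.tL β′ → β′ ≈ β))
      β-data = IsRMMaterialization.universal I.rm i S.α i-regular α∘i≈f

    β : GL ⇒ τ.L′
    β = proj₁ β-data

    f″∘β≈α : I.f″ ∘ β ≈ S.α
    f″∘β≈α = proj₁ (proj₁ (proj₂ β-data))

    match-pullback : IsPullback id i τ.tL β
    match-pullback = proj₂ (proj₁ (proj₂ β-data))

    β∘i≈tL : β ∘ i ≈ τ.tL
    β∘i≈tL = trans≈ (sym≈ (IsPullback.commute match-pullback)) identityʳ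

    private
      f″∘β∘gL : I.f″ ∘ (β ∘ S.gL) ≈ ρ.l′ ∘ S.u′
      f″∘β∘gL = trans≈ (pullˡ f″∘β≈α) (IsPullback.commute S.pb)

    u′⁺ : S.GK ⇒ τ.K′
    u′⁺ = pb-med I.pb-F′ (β ∘ S.gL) S.u′ f″∘β∘gL

    interface-pullback : IsPullback S.gL u′⁺ β τ.l′
    interface-pullback = pullback-unpasting I.pb-F′
      (IsPullback-resp-≈ refl≈ (sym≈ (pb-med-p₂ I.pb-F′ _ _ f″∘β∘gL)) (sym≈ f″∘β≈α) refl≈ S.pb)
      (sym≈ (pb-med-p₁ I.pb-F′ _ _ f″∘β∘gL))

    private
      β∘i∘l : β ∘ (i ∘ τ.l) ≈ τ.l′ ∘ τ.tK
      β∘i∘l = trans≈ (pullˡ β∘i≈tL) (IsPullback.commute τ.pb)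

    u⁺ : τ.K ⇒ S.GK
    u⁺ = pb-med interface-pullback (i ∘ τ.l) τ.tK β∘i∘l

    gL∘u⁺ : S.gL ∘ u⁺ ≈ i ∘ τ.l
    gL∘u⁺ = pb-med-p₁ interface-pullback _ _ β∘i∘l

    u′⁺∘u⁺ : u′⁺ ∘ u⁺ ≈ τ.tK
    u′⁺∘u⁺ = pb-med-p₂ interface-pullback _ _ β∘i∘l

    -- Any v typed by tK lands in the match i, because the match square is a pullback.
    u⁺-unique : ∀ (v : τ.K ⇒ S.GK) → u′⁺ ∘ v ≈ τ.tK → v ≈ u⁺
    u⁺-unique v u′⁺∘v = pb-jointly-mono interface-pullback (trans≈ gL∘v (sym≈ gL∘u⁺)) (trans≈ u′⁺∘v (sym≈ u′⁺∘u⁺))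
      where
        tL∘l≈β∘gL∘v : τ.tL ∘ τ.l ≈ β ∘ (S.gL ∘ v)
        tL∘l≈β∘gL∘v = begin
          τ.tL ∘ τ.l         ≈⟨ IsPullback.commute τ.pb ⟩
          τ.l′ ∘ τ.tK        ≈⟨ ∘-resp-≈ʳ u′⁺∘v ⟨
          τ.l′ ∘ (u′⁺ ∘ v)   ≈⟨ extendʳ (IsPullback.commute interface-pullback) ⟨
          β ∘ (S.gL ∘ v)     ∎
        gL∘v : S.gL ∘ v ≈ i ∘ τ.l
        gL∘v = trans≈ (sym≈ (pb-med-p₂ match-pullback _ _ tL∘l≈β∘gL∘v))
                      (∘-resp-≈ʳ (trans≈ (sym≈ identityˡ) (pb-med-p₁ match-pullback _ _ tL∘l≈β∘gL∘v)))

    u⁺∘j≈u : u⁺ ∘ I.j ≈ S.u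
    u⁺∘j≈u = pb-jointly-mono S.pb
      (begin
        S.gL ∘ (u⁺ ∘ I.j)   ≈⟨ pullˡ gL∘u⁺ ⟩
        (i ∘ τ.l) ∘ I.j     ≈⟨ pullʳ I.j-l ⟩
        i ∘ (I.e ∘ ρ.l)     ≈⟨ pullˡ i∘e≈m ⟩
        S.m ∘ ρ.l           ≈⟨ S.u-l ⟨
        S.gL ∘ S.u          ∎)
      (begin
        S.u′ ∘ (u⁺ ∘ I.j)           ≈⟨ ∘-resp-≈ˡ (pb-med-p₂ I.pb-F′ _ _ f″∘β∘gL) ⟨
        (I.q ∘ u′⁺) ∘ (u⁺ ∘ I.j)    ≈⟨ pullʳ (pullˡ u′⁺∘u⁺) ⟩
        I.q ∘ (τ.tK ∘ I.j)          ≈⟨ ∘-resp-≈ʳ I.j-k ⟩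
        I.q ∘ I.h                   ≈⟨ I.h-q ⟩
        ρ.tK                        ≈⟨ S.u-t ⟨
        S.u′ ∘ S.u                  ∎)

    private
      gR∘u⁺∘j : (S.gR ∘ u⁺) ∘ I.j ≈ S.w ∘ ρ.r
      gR∘u⁺∘j = trans≈ (pullʳ u⁺∘j≈u) (IsPushout.commute S.po)

    w⁺ : τ.R ⇒ GR
    w⁺ = po-med I.po-Re (S.gR ∘ u⁺) S.w gR∘u⁺∘j

    result-pushout : IsPushout S.gR w⁺ u⁺ τ.r
    result-pushout = pushout-unpasting I.po-Re
      (IsPushout-resp-≈ refl≈ (sym≈ (po-med-i₂ I.po-Re _ _ gR∘u⁺∘j)) (sym≈ u⁺∘j≈u) refl≈ S.po)
      (sym≈ (po-med-i₁ I.po-Re _ _ gR∘u⁺∘j))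

    step⁺ : PBPO⁺Step τ GL GR
    step⁺ = record
      { m = i ; α = β ; α-m = β∘i≈tL ; match-pb = match-pullback
      ; GK = S.GK ; gL = S.gL ; u′ = u′⁺ ; pb-GK = interface-pullback
      ; u = u⁺ ; u-t = u′⁺∘u⁺ ; u-unique = u⁺-unique
      ; gR = S.gR ; w = w⁺ ; po = result-pushout }

  module Compaction
    (pullback : ∀ {A B D} (f : A ⇒ D) (g : B ⇒ D) → Pullback f g)
    (pushout : ∀ {A B D} (f : D ⇒ A) (g : D ⇒ B) → Pushout f g)
    (factorize : ∀ {A B} (m : A ⇒ B) → EpiRegularMonoFactorization m)
    (rm-materialization : ∀ {A B} (f : A ⇒ B) → RMMaterialization f)
    where

    compacted-rule : (ρ : PBPORule) {Le : Obj} (e : PBPORule.L ρ ⇒ Le) → Epi e →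
                     (f : Le ⇒ PBPORule.L′ ρ) → f ∘ e ≈ PBPORule.tL ρ → Σ[ τ ∈ PBPO⁺Rule ] InCompact ρ τ
    compacted-rule ρ e e-epi f f∘e≈tL = τ , ic
      where
        module ρ = PBPORule ρ
        module M = RMMaterialization (rm-materialization f)
        module F′ = Pullback (pullback M.f″ ρ.l′)
        module Ke = Pullback (pullback M.f′ F′.p₁)
        f″∘f′∘e∘l : M.f″ ∘ (M.f′ ∘ (e ∘ ρ.l)) ≈ ρ.l′ ∘ ρ.tK
        f″∘f′∘e∘l = begin
          M.f″ ∘ (M.f′ ∘ (e ∘ ρ.l))  ≈⟨ pullˡ (IsRMMaterialization.factor M.isRM) ⟩
          f ∘ (e ∘ ρ.l)              ≈⟨ pullˡ f∘e≈tL ⟩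
          ρ.tL ∘ ρ.l                 ≈⟨ ρ.left-comm ⟩
          ρ.l′ ∘ ρ.tK                ∎
        h : ρ.K ⇒ F′.P
        h = pb-med F′.isPullback _ _ f″∘f′∘e∘l
        h-p : F′.p₁ ∘ h ≈ M.f′ ∘ (e ∘ ρ.l)
        h-p = pb-med-p₁ F′.isPullback _ _ f″∘f′∘e∘l
        j : ρ.K ⇒ Ke.P
        j = pb-med Ke.isPullback (e ∘ ρ.l) h (sym≈ h-p)
        module Re = Pushout (pushout j ρ.r)
        τ : PBPO⁺Rule
        τ = record { l = Ke.p₁ ; r = Re.i₁ ; tL = M.f′ ; tK = Ke.p₂ ; l′ = F′.p₁ ; pb = Ke.isPullback }
        ic : InCompact ρ τ
        ic = record
          { e = e ; e-epi = e-epi ; f = f ; factor = f∘e≈tL ; f″ = M.f″ ; rm = M.isRM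
          ; q = F′.p₂ ; pb-F′ = F′.isPullback ; pb-Ke = Ke.isPullback
          ; h = h ; h-p = h-p ; h-q = pb-med-p₂ F′.isPullback _ _ f″∘f′∘e∘l
          ; j = j ; j-l = pb-med-p₁ Ke.isPullback _ _ (sym≈ h-p) ; j-k = pb-med-p₂ Ke.isPullback _ _ (sym≈ h-p)
          ; s = Re.i₂ ; po-Re = Re.isPushout }

    PBPOStep⇒compact-PBPO⁺Step : ∀ {ρ GL GR} → PBPOStep ρ GL GR →
                                 Σ[ τ ∈ PBPO⁺Rule ] (InCompact ρ τ × PBPO⁺Step τ GL GR)
    PBPOStep⇒compact-PBPO⁺Step {ρ} st = τ , ic , CompactedStep.step⁺ ic st M.regular M.factors refl≈
      where
        module S = PBPOStep st
        module M = EpiRegularMonoFactorization (factorize S.m)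
        compacted : Σ[ τ ∈ PBPO⁺Rule ] InCompact ρ τ
        compacted = compacted-rule ρ M.e M.epi (S.α ∘ M.i) (trans≈ (pullʳ M.factors) S.α-m)
        τ : PBPO⁺Rule
        τ = proj₁ compacted
        ic : InCompact ρ τ
        ic = proj₂ compacted

theorem2 : ∀ {o ℓ e : Level} (C : Category o ℓ e) → let open Notions C in
    Quasitopos → (ρ : PBPORule) → Canonical ρ →
    ∀ (GL GR : Category.Obj C) →
      (PBPOStep ρ GL GR → Σ[ τ ∈ PBPO⁺Rule ] (InCompact ρ τ × PBPO⁺Step τ GL GR)) ×
      (Σ[ τ ∈ PBPO⁺Rule ] (InCompact ρ τ × PBPO⁺Step τ GL GR) → PBPOStep ρ GL GR)
theorem2 C Q ρ _ GL GR =
  PBPOStep⇒compact-PBPO⁺Step , λ (_ , ic , step⁺) → compact-PBPO⁺Step⇒PBPOStep ic step⁺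
  where
    open Rewriting C
    open QuasitoposProperties C Q
    open Compaction pullback pushout epi-regular-factorization rm-materialization
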